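{- For positive integers $k,m$ with $m\geq k$ we have $J(k,m)<(14m/k)^k$.
   Context: $J(k,m)$ is the number of $k$-tuples of integers $(x_1,\dots,x_k)$ satisfying $\sum_{i=1}^k x_i^+=\sum_{i=1}^k x_i^-\leq m$, where $x^+=\max(x,0)$ and $x^-=\max(-x,0)$. -}

module Defs where

open import Data.Nat using (ℕ; zero; suc; _+_; _≤_; _≟_; _≤?_)
open import Data.Integer using (ℤ; +_; -[1+_])
open import Data.List using (List; []; _∷_; _++_; map; upTo; concatMap; filter; length)
open import Data.Vec using (Vec; []; _∷_)
open import Data.Product using (_×_)
open import Relation.Binary.PropositionalEquality using (_≡_)
open import Relation.Nullary using (Dec; yes; no)
open import Relation.Nullary.Decidable using (_×-dec_)

pos : ℤ → ℕ
pos (+ n)    = n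
pos -[1+ n ] = 0

neg : ℤ → ℕ
neg (+ n)    = 0
neg -[1+ n ] = suc n

sumPos : ∀ {k} → Vec ℤ k → ℕ
sumPos []       = 0
sumPos (x ∷ xs) = pos x + sumPos xs

sumNeg : ∀ {k} → Vec ℤ k → ℕ
sumNeg []       = 0
sumNeg (x ∷ xs) = neg x + sumNeg xs

Cond : ∀ {k} → ℕ → Vec ℤ k → Set
Cond m xs = (sumPos xs ≡ sumNeg xs) × (sumNeg xs ≤ m)

cond? : ∀ {k} (m : ℕ) (xs : Vec ℤ k) → Dec (Cond m xs)
cond? m xs = (sumPos xs ≟ sumNeg xs) ×-dec (sumNeg xs ≤? m)

-- the integers -m, …, m (each exactly once)
range : ℕ → List ℤ
range m = map +_ (upTo (suc m)) ++ map -[1+_] (upTo m)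

box : (k m : ℕ) → List (Vec ℤ k)
box zero    m = [] ∷ []
box (suc k) m = concatMap (λ x → map (x ∷_) (box k m)) (range m)

-- J(k,m): any tuple satisfying Cond m has |xᵢ| ≤ m, so it lies in the box;
-- hence this counts all integer k-tuples satisfying the condition.
J : ℕ → ℕ → ℕ
J k m = length (filter (cond? m) (box k m))

-- Rankin's trick.  Give an integer x the weight (p/q)^|x| with q = p + k.  A tuple counted by
-- J k m has Σ|xᵢ| = 2 Σ xᵢ⁻ ≤ 2m, so its weight is at least (p/q)^(2m), while the total weight
-- of all tuples with entries in [-m, m] is (Σ_{|x| ≤ m} (p/q)^|x|)^k ≤ ((q + p)/k)^k by the
-- geometric series.  Hence J k m ≤ (q/p)^(2m) ((q + p)/k)^k, and p = 2m - k gives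
-- J k m ≤ (1 + k/p)^(p+k) ((4m - k)/k)^k.  As (1 + k/a)^(a+k) decreases in a (Bernoulli),
-- (1 + k/p)^(p+k) ≤ ((c + 1)/c)^((c+1)k) whenever p ≥ c k; c = 1 handles m < 2k and c = 3
-- handles m ≥ 2k, in both cases with room to spare below 14.
module Submission where

open import Defs
open import Data.Nat
  using (ℕ; zero; suc; _+_; _*_; _^_; _∸_; _<_; _≤_; _≤′_; z≤n; s≤s; z<s; ≤′-refl; ≤′-step; NonZero; >-nonZero; >-nonZero⁻¹)
open import Data.Nat.Properties
open import Data.Nat.Tactic.RingSolver using (solve-∀)
open import Algebra.Properties.CommutativeSemigroup *-commutativeSemigroup
  using (interchange; x∙yz≈y∙xz; x∙yz≈xz∙y; xy∙z≈x∙zy; xy∙z≈xz∙y; xy∙z≈zx∙y)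
open import Algebra.Properties.CommutativeSemigroup +-commutativeSemigroup
  using () renaming (interchange to +-interchange)
open import Data.Integer using (ℤ; -[1+_]; ∣_∣)
import Data.Integer as ℤ
open import Data.List using (List; []; _∷_; _++_; map; upTo; applyUpTo; concatMap; filter; length)
open import Data.List.Properties using (map-++; map-∘; map-applyUpTo)
open import Data.Nat.ListAction using (sum)
open import Data.Nat.ListAction.Properties using (sum-++)
open import Data.Vec using (Vec; []; _∷_)
import Data.Vec as Vec
open import Data.Product using (_,_)
open import Data.Sum using (inj₁; inj₂)
open import Function using (_∘_)
open import Relation.Binary.PropositionalEquality hiding (J)
open import Relation.Nullary using (Dec; yes; no)

^-distribʳ-* : ∀ m n o → (m * n) ^ o ≡ m ^ o * n ^ o
^-distribʳ-* m n zero    = refl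
^-distribʳ-* m n (suc o) = trans (cong ((m * n) *_) (^-distribʳ-* m n o)) (interchange m n (m ^ o) (n ^ o))

length-filter*≤sum-map* : ∀ {A : Set} {P : A → Set} (P? : ∀ x → Dec (P x)) (w : A → ℕ) c e →
                          (∀ x → P x → c ≤ w x * e) → ∀ xs → length (filter P? xs) * c ≤ sum (map w xs) * e
length-filter*≤sum-map* P? w c e c≤we []       = z≤n
length-filter*≤sum-map* P? w c e c≤we (x ∷ xs) with P? x
... | yes px = ≤-trans (+-mono-≤ (c≤we x px) (length-filter*≤sum-map* P? w c e c≤we xs))
                       (≤-reflexive (sym (*-distribʳ-+ e (w x) (sum (map w xs)))))
... | no  _  = ≤-trans (length-filter*≤sum-map* P? w c e c≤we xs)
                       (*-monoˡ-≤ e (m≤n+m (sum (map w xs)) (w x)))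

sum-applyUpTo-scale : ∀ c (g h : ℕ → ℕ) n → (∀ j → g j ≡ c * h j) →
                      sum (applyUpTo g n) ≡ c * sum (applyUpTo h n)
sum-applyUpTo-scale c g h zero    g≡c*h = sym (*-zeroʳ c)
sum-applyUpTo-scale c g h (suc n) g≡c*h = begin
  g 0 + sum (applyUpTo (g ∘ suc) n)      ≡⟨ cong₂ _+_ (g≡c*h 0) (sum-applyUpTo-scale c (g ∘ suc) (h ∘ suc) n (g≡c*h ∘ suc)) ⟩
  c * h 0 + c * sum (applyUpTo (h ∘ suc) n) ≡⟨ *-distribˡ-+ c (h 0) _ ⟨
  c * sum (applyUpTo h (suc n))          ∎
  where open ≡-Reasoning

geometric-sum : ∀ p d n → d * sum (applyUpTo (λ j → p ^ j * (p + d) ^ (n ∸ j)) (suc n)) + p ^ suc n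
                          ≡ (p + d) ^ suc n
geometric-sum p d zero    = trans (+-comm (d * 1) (p * 1)) (sym (*-distribʳ-+ 1 p d))
geometric-sum p d (suc n) = begin
  d * (1 * X + sum (applyUpTo (λ j → p ^ suc j * q ^ (n ∸ j)) (suc n))) + p * p ^ suc n
    ≡⟨ cong (λ s → d * (1 * X + s) + p * p ^ suc n)
            (sum-applyUpTo-scale p _ _ (suc n) (λ j → *-assoc p (p ^ j) (q ^ (n ∸ j)))) ⟩
  d * (1 * X + p * G) + p * p ^ suc n   ≡⟨ regroup d X p G (p ^ suc n) ⟩
  d * X + p * (d * G + p ^ suc n)       ≡⟨ cong (λ y → d * X + p * y) (geometric-sum p d n) ⟩
  d * X + p * X                         ≡⟨ +-comm (d * X) (p * X) ⟩
  p * X + d * X                         ≡⟨ *-distribʳ-+ X p d ⟨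
  q * X                                 ∎
  where
  open ≡-Reasoning
  q = p + d
  X = q ^ suc n
  G = sum (applyUpTo (λ j → p ^ j * q ^ (n ∸ j)) (suc n))
  regroup : ∀ d X p G Y → d * (1 * X + p * G) + p * Y ≡ d * X + p * (d * G + Y)
  regroup = solve-∀

weight : ∀ {A : Set} {k} → (A → ℕ) → Vec A k → ℕ
weight f []       = 1
weight f (x ∷ xs) = f x * weight f xs

module _ {A : Set} (f : A → ℕ) where

  sum-weight-map-∷ : ∀ {k} x (B : List (Vec A k)) →
                     sum (map (weight f) (map (x ∷_) B)) ≡ f x * sum (map (weight f) B)
  sum-weight-map-∷ x []      = sym (*-zeroʳ (f x))
  sum-weight-map-∷ x (b ∷ B) = trans (cong (_+_ (f x * weight f b)) (sum-weight-map-∷ x B))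
                                     (sym (*-distribˡ-+ (f x) (weight f b) _))

  sum-weight-concatMap : ∀ {k} (R : List A) (B : List (Vec A k)) →
                         sum (map (weight f) (concatMap (λ x → map (x ∷_) B) R))
                         ≡ sum (map f R) * sum (map (weight f) B)
  sum-weight-concatMap []      B = refl
  sum-weight-concatMap (x ∷ R) B = begin
    sum (map (weight f) (map (x ∷_) B ++ rest))
      ≡⟨ cong sum (map-++ (weight f) (map (x ∷_) B) rest) ⟩
    sum (map (weight f) (map (x ∷_) B) ++ map (weight f) rest)
      ≡⟨ sum-++ (map (weight f) (map (x ∷_) B)) (map (weight f) rest) ⟩
    sum (map (weight f) (map (x ∷_) B)) + sum (map (weight f) rest)
      ≡⟨ cong₂ _+_ (sum-weight-map-∷ x B) (sum-weight-concatMap R B) ⟩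
    f x * sum (map (weight f) B) + sum (map f R) * sum (map (weight f) B)
      ≡⟨ *-distribʳ-+ (sum (map (weight f) B)) (f x) (sum (map f R)) ⟨
    (f x + sum (map f R)) * sum (map (weight f) B) ∎
    where
    open ≡-Reasoning
    rest = concatMap (λ x → map (x ∷_) B) R

sum-weight-box : ∀ (f : ℤ → ℕ) k m → sum (map (weight f) (box k m)) ≡ sum (map f (range m)) ^ k
sum-weight-box f zero    m = refl
sum-weight-box f (suc k) m =
  trans (sum-weight-concatMap f (range m) (box k m)) (cong (sum (map f (range m)) *_) (sum-weight-box f k m))

sum-range-∣∣ : ∀ (g : ℕ → ℕ) m → sum (map (g ∘ ∣_∣) (range m)) + g 0
                                  ≡ sum (applyUpTo g (suc m)) + sum (applyUpTo g (suc m))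
sum-range-∣∣ g m = begin
  sum (map (g ∘ ∣_∣) (map ℤ.+_ (upTo (suc m)) ++ map -[1+_] (upTo m))) + g 0
    ≡⟨ cong (λ xs → sum xs + g 0) (map-++ (g ∘ ∣_∣) (map ℤ.+_ (upTo (suc m))) (map -[1+_] (upTo m))) ⟩
  sum (map (g ∘ ∣_∣) (map ℤ.+_ (upTo (suc m))) ++ map (g ∘ ∣_∣) (map -[1+_] (upTo m))) + g 0
    ≡⟨ cong (_+ g 0) (sum-++ (map (g ∘ ∣_∣) (map ℤ.+_ (upTo (suc m)))) _) ⟩
  sum (map (g ∘ ∣_∣) (map ℤ.+_ (upTo (suc m)))) + sum (map (g ∘ ∣_∣) (map -[1+_] (upTo m))) + g 0
    ≡⟨ cong₂ (λ a b → sum a + sum b + g 0) (onNaturals ℤ.+_ (suc m)) (onNaturals -[1+_] m) ⟩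
  sum (applyUpTo g (suc m)) + sum (applyUpTo (g ∘ suc) m) + g 0
    ≡⟨ +-assoc (sum (applyUpTo g (suc m))) _ (g 0) ⟩
  sum (applyUpTo g (suc m)) + (sum (applyUpTo (g ∘ suc) m) + g 0)
    ≡⟨ cong (sum (applyUpTo g (suc m)) +_) (+-comm _ (g 0)) ⟩
  sum (applyUpTo g (suc m)) + sum (applyUpTo g (suc m)) ∎
  where
  open ≡-Reasoning
  onNaturals : (ι : ℕ → ℤ) (n : ℕ) → map (g ∘ ∣_∣) (map ι (upTo n)) ≡ applyUpTo (g ∘ ∣_∣ ∘ ι) n
  onNaturals ι n = trans (sym (map-∘ (upTo n))) (map-applyUpTo (λ j → j) (g ∘ ∣_∣ ∘ ι) n)

∣x∣≡pos+neg : ∀ x → ∣ x ∣ ≡ pos x + neg x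
∣x∣≡pos+neg (ℤ.+ n)  = sym (+-identityʳ n)
∣x∣≡pos+neg -[1+ n ] = refl

sum-∣∣≡sumPos+sumNeg : ∀ {k} (xs : Vec ℤ k) → Vec.sum (Vec.map ∣_∣ xs) ≡ sumPos xs + sumNeg xs
sum-∣∣≡sumPos+sumNeg []       = refl
sum-∣∣≡sumPos+sumNeg (x ∷ xs) =
  trans (cong₂ _+_ (∣x∣≡pos+neg x) (sum-∣∣≡sumPos+sumNeg xs))
        (+-interchange (pos x) (neg x) (sumPos xs) (sumNeg xs))

Cond⇒sum-∣∣≤m+m : ∀ {k} m (xs : Vec ℤ k) → Cond m xs → Vec.sum (Vec.map ∣_∣ xs) ≤ m + m
Cond⇒sum-∣∣≤m+m m xs (pos≡neg , neg≤m) = begin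
  Vec.sum (Vec.map ∣_∣ xs) ≡⟨ sum-∣∣≡sumPos+sumNeg xs ⟩
  sumPos xs + sumNeg xs    ≡⟨ cong (_+ sumNeg xs) pos≡neg ⟩
  sumNeg xs + sumNeg xs    ≤⟨ +-mono-≤ neg≤m neg≤m ⟩
  m + m                    ∎
  where open ≤-Reasoning

p^a*x≤y*q^a⇒p^b*x≤y*q^b : ∀ {p q x y a b} → p ≤ q → p ^ a * x ≤ y * q ^ a → a ≤ b → p ^ b * x ≤ y * q ^ b
p^a*x≤y*q^a⇒p^b*x≤y*q^b {p} {q} {x} {y} {a} p≤q bound a≤b with m≤n⇒∃[o]m+o≡n a≤b
... | r , refl = begin
  p ^ (a + r) * x       ≡⟨ cong (_* x) (^-distribˡ-+-* p a r) ⟩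
  p ^ a * p ^ r * x     ≡⟨ xy∙z≈xz∙y (p ^ a) (p ^ r) x ⟩
  p ^ a * x * p ^ r     ≤⟨ *-mono-≤ bound (^-monoˡ-≤ r p≤q) ⟩
  y * q ^ a * q ^ r     ≡⟨ *-assoc y (q ^ a) (q ^ r) ⟩
  y * (q ^ a * q ^ r)   ≡⟨ cong (y *_) (^-distribˡ-+-* q a r) ⟨
  y * q ^ (a + r)       ∎
  where open ≤-Reasoning

module RankinWeight (p d m : ℕ) .{{_ : NonZero (p + d)}} where

  q : ℕ
  q = p + d

  -- q^m (p/q)^|x| for |x| ≤ m, i.e. on all of range m
  f : ℤ → ℕ
  f x = p ^ ∣ x ∣ * q ^ (m ∸ ∣ x ∣)

  f-lower : ∀ x → p ^ ∣ x ∣ * q ^ m ≤ f x * q ^ ∣ x ∣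
  f-lower x = begin
    p ^ a * q ^ m                 ≤⟨ *-monoʳ-≤ (p ^ a) (^-monoʳ-≤ q (m≤n+m∸n m a)) ⟩
    p ^ a * q ^ (a + (m ∸ a))     ≡⟨ cong (p ^ a *_) (^-distribˡ-+-* q a (m ∸ a)) ⟩
    p ^ a * (q ^ a * q ^ (m ∸ a)) ≡⟨ x∙yz≈xz∙y (p ^ a) (q ^ a) (q ^ (m ∸ a)) ⟩
    f x * q ^ a                   ∎
    where
    open ≤-Reasoning
    a = ∣ x ∣

  weight-lower : ∀ {k} (xs : Vec ℤ k) → let a = Vec.sum (Vec.map ∣_∣ xs) in
                 p ^ a * q ^ (k * m) ≤ weight f xs * q ^ a
  weight-lower []       = ≤-refl
  weight-lower {suc k} (x ∷ xs) = begin
    p ^ (a + b) * q ^ (m + k * m)             ≡⟨ cong₂ _*_ (^-distribˡ-+-* p a b) (^-distribˡ-+-* q m (k * m)) ⟩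
    p ^ a * p ^ b * (q ^ m * q ^ (k * m))     ≡⟨ interchange (p ^ a) (p ^ b) (q ^ m) (q ^ (k * m)) ⟩
    p ^ a * q ^ m * (p ^ b * q ^ (k * m))     ≤⟨ *-mono-≤ (f-lower x) (weight-lower xs) ⟩
    f x * q ^ a * (weight f xs * q ^ b)       ≡⟨ interchange (f x) (q ^ a) (weight f xs) (q ^ b) ⟩
    f x * weight f xs * (q ^ a * q ^ b)       ≡⟨ cong (f x * weight f xs *_) (^-distribˡ-+-* q a b) ⟨
    f x * weight f xs * q ^ (a + b)           ∎
    where
    open ≤-Reasoning
    a = ∣ x ∣
    b = Vec.sum (Vec.map ∣_∣ xs)

  Cond⇒weight-lower : ∀ {k} (xs : Vec ℤ k) → Cond m xs → p ^ (m + m) * q ^ (k * m) ≤ weight f xs * q ^ (m + m)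
  Cond⇒weight-lower xs cond =
    p^a*x≤y*q^a⇒p^b*x≤y*q^b {y = weight f xs} (m≤m+n p d) (weight-lower xs) (Cond⇒sum-∣∣≤m+m m xs cond)

  d*sum-f-range≤ : d * sum (map f (range m)) ≤ (q + p) * q ^ m
  d*sum-f-range≤ = +-cancelʳ-≤ (d * (1 * D)) _ _ (begin
    d * S + d * (1 * D)                ≡⟨ *-distribˡ-+ d S (1 * D) ⟨
    d * (S + 1 * D)                    ≡⟨ cong (d *_) (sum-range-∣∣ g m) ⟩
    d * (G + G)                        ≡⟨ *-distribˡ-+ d G G ⟩
    d * G + d * G                      ≤⟨ +-mono-≤ (m≤m+n (d * G) (p ^ suc m)) (m≤m+n (d * G) (p ^ suc m)) ⟩
    (d * G + p ^ suc m) + (d * G + p ^ suc m) ≡⟨ cong₂ _+_ (geometric-sum p d m) (geometric-sum p d m) ⟩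
    q * D + q * D                      ≡⟨ regroup p d D ⟩
    (q + p) * D + d * (1 * D)          ∎)
    where
    open ≤-Reasoning
    D = q ^ m
    g : ℕ → ℕ
    g j = p ^ j * q ^ (m ∸ j)
    S = sum (map f (range m))
    G = sum (applyUpTo g (suc m))
    regroup : ∀ p d D → (p + d) * D + (p + d) * D ≡ (p + d + p) * D + d * (1 * D)
    regroup = solve-∀

  rankin-bound : ∀ k → J k m * p ^ (m + m) * d ^ k ≤ q ^ (m + m) * (q + p) ^ k
  rankin-bound k = *-cancelʳ-≤ _ _ (q ^ (k * m)) {{m^n≢0 q (k * m)}} (begin
    J k m * P * d ^ k * q ^ (k * m)            ≡⟨ xy∙z≈xz∙y (J k m * P) (d ^ k) (q ^ (k * m)) ⟩
    J k m * P * q ^ (k * m) * d ^ k            ≡⟨ cong (_* d ^ k) (*-assoc (J k m) P (q ^ (k * m))) ⟩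
    J k m * (P * q ^ (k * m)) * d ^ k          ≤⟨ *-monoˡ-≤ (d ^ k) counted ⟩
    sum (map (weight f) (box k m)) * Q * d ^ k ≡⟨ cong (λ s → s * Q * d ^ k) (sum-weight-box f k m) ⟩
    S ^ k * Q * d ^ k                          ≡⟨ xy∙z≈xz∙y (S ^ k) Q (d ^ k) ⟩
    S ^ k * d ^ k * Q                          ≡⟨ cong (_* Q) (trans (*-comm (S ^ k) (d ^ k)) (sym (^-distribʳ-* d S k))) ⟩
    (d * S) ^ k * Q                            ≤⟨ *-monoˡ-≤ Q (^-monoˡ-≤ k d*sum-f-range≤) ⟩
    ((q + p) * q ^ m) ^ k * Q                  ≡⟨ cong (_* Q) (^-distribʳ-* (q + p) (q ^ m) k) ⟩
    (q + p) ^ k * (q ^ m) ^ k * Q              ≡⟨ cong (λ e → (q + p) ^ k * e * Q) (trans (^-*-assoc q m k) (cong (q ^_) (*-comm m k))) ⟩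
    (q + p) ^ k * q ^ (k * m) * Q              ≡⟨ xy∙z≈zx∙y ((q + p) ^ k) (q ^ (k * m)) Q ⟩
    Q * (q + p) ^ k * q ^ (k * m)              ∎)
    where
    open ≤-Reasoning
    P = p ^ (m + m)
    Q = q ^ (m + m)
    S = sum (map f (range m))
    counted : J k m * (P * q ^ (k * m)) ≤ sum (map (weight f) (box k m)) * Q
    counted = length-filter*≤sum-map* (cond? m) (weight f) _ Q Cond⇒weight-lower (box k m)

bernoulli : ∀ n v k → v ^ n * (v + n * k) ≤ (v + k) ^ n * v
bernoulli zero    v k = ≤-reflexive (cong (1 *_) (+-identityʳ v))
bernoulli (suc n) v k = begin
  v * X * (v + suc n * k)                 ≤⟨ m≤m+n _ (n * k * k * X) ⟩
  v * X * (v + suc n * k) + n * k * k * X ≡⟨ expand v k n X ⟩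
  (v + k) * (X * (v + n * k))             ≤⟨ *-monoʳ-≤ (v + k) (bernoulli n v k) ⟩
  (v + k) * ((v + k) ^ n * v)             ≡⟨ *-assoc (v + k) ((v + k) ^ n) v ⟨
  (v + k) ^ suc n * v                     ∎
  where
  open ≤-Reasoning
  X = v ^ n
  expand : ∀ v k n X → v * X * (v + suc n * k) + n * k * k * X ≡ (v + k) * (X * (v + n * k))
  expand = solve-∀

[1+k/a]^[a+k]-antitone-step : ∀ a k .{{_ : NonZero a}} →
                              a ^ (a + k) * suc (a + k) ^ suc (a + k) ≤ suc a ^ suc (a + k) * (a + k) ^ (a + k)
-- With v = a (N + 1) one has (a + 1) N = v + k, so Bernoulli bounds ((a + 1) N)^N from below.
[1+k/a]^[a+k]-antitone-step a k = *-cancelʳ-≤ _ _ v {{m*n≢0 a (suc N)}} (begin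
  a ^ N * (suc N * suc N ^ N) * v      ≡⟨ cong (_* v) (x∙yz≈y∙xz (a ^ N) (suc N) (suc N ^ N)) ⟩
  suc N * (a ^ N * suc N ^ N) * v      ≡⟨ cong (λ y → suc N * y * v) (^-distribʳ-* a (suc N) N) ⟨
  suc N * X * v                        ≤⟨ m≤m+n _ (k * k * X) ⟩
  suc N * X * v + k * k * X            ≡⟨ slack a k X ⟩
  suc a * (X * (v + N * k))            ≤⟨ *-monoʳ-≤ (suc a) (bernoulli N v k) ⟩
  suc a * ((v + k) ^ N * v)            ≡⟨ cong (λ y → suc a * (y ^ N * v)) (v+k≡[1+a]N a k) ⟩
  suc a * ((suc a * N) ^ N * v)        ≡⟨ cong (λ y → suc a * (y * v)) (^-distribʳ-* (suc a) N N) ⟩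
  suc a * (suc a ^ N * N ^ N * v)      ≡⟨ reassoc (suc a) (suc a ^ N) (N ^ N) v ⟩
  suc a ^ suc N * N ^ N * v            ∎)
  where
  open ≤-Reasoning
  N = a + k
  v = a * suc N
  X = v ^ N
  slack : ∀ a k X → suc (a + k) * X * (a * suc (a + k)) + k * k * X
                    ≡ suc a * (X * (a * suc (a + k) + (a + k) * k))
  slack = solve-∀
  v+k≡[1+a]N : ∀ a k → a * suc (a + k) + k ≡ suc a * (a + k)
  v+k≡[1+a]N = solve-∀
  reassoc : ∀ s x y v → s * (x * y * v) ≡ s * x * y * v
  reassoc = solve-∀

[1+k/a]^[a+k]-antitone : ∀ k {a b} .{{_ : NonZero a}} → a ≤ b →
                         a ^ (a + k) * (b + k) ^ (b + k) ≤ b ^ (b + k) * (a + k) ^ (a + k)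
[1+k/a]^[a+k]-antitone k {a} a≤b = go (≤⇒≤′ a≤b)
  where
  go : ∀ {b} → a ≤′ b → a ^ (a + k) * (b + k) ^ (b + k) ≤ b ^ (b + k) * (a + k) ^ (a + k)
  go ≤′-refl = ≤-refl
  go {suc b} (≤′-step a≤′b) = *-cancelʳ-≤ _ _ (b ^ (b + k)) {{m^n≢0 b (b + k) {{b≢0}}}} (begin
    G₀ * F₁ * Gb   ≡⟨ xy∙z≈x∙zy G₀ F₁ Gb ⟩
    G₀ * (Gb * F₁) ≤⟨ *-monoʳ-≤ G₀ ([1+k/a]^[a+k]-antitone-step b k {{b≢0}}) ⟩
    G₀ * (G₁ * Fb) ≡⟨ x∙yz≈y∙xz G₀ G₁ Fb ⟩
    G₁ * (G₀ * Fb) ≤⟨ *-monoʳ-≤ G₁ (go a≤′b) ⟩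
    G₁ * (Gb * F₀) ≡⟨ x∙yz≈xz∙y G₁ Gb F₀ ⟩
    G₁ * F₀ * Gb   ∎)
    where
    open ≤-Reasoning
    b≢0 : NonZero b
    b≢0 = >-nonZero (<-≤-trans (>-nonZero⁻¹ a) (≤′⇒≤ a≤′b))
    G₀ = a ^ (a + k)
    F₀ = (a + k) ^ (a + k)
    Gb = b ^ (b + k)
    Fb = (b + k) ^ (b + k)
    G₁ = suc b ^ suc (b + k)
    F₁ = suc (b + k) ^ suc (b + k)

[a*k]^[b*k]≡[a^b]^k*k^[b*k] : ∀ a b k → (a * k) ^ (b * k) ≡ (a ^ b) ^ k * k ^ (b * k)
[a*k]^[b*k]≡[a^b]^k*k^[b*k] a b k =
  trans (^-distribʳ-* a k (b * k)) (cong (_* k ^ (b * k)) (sym (^-*-assoc a b k)))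

[1+k/p]^[p+k]≤[1+1/c]^[[1+c]k] : ∀ c k p .{{_ : NonZero c}} .{{_ : NonZero k}} → c * k ≤ p →
                                 (c ^ suc c) ^ k * (p + k) ^ (p + k) ≤ (suc c ^ suc c) ^ k * p ^ (p + k)
[1+k/p]^[p+k]≤[1+1/c]^[[1+c]k] c k p ck≤p = *-cancelʳ-≤ _ _ K {{m^n≢0 k E}} (begin
  C * (p + k) ^ (p + k) * K ≡⟨ xy∙z≈xz∙y C ((p + k) ^ (p + k)) K ⟩
  C * K * (p + k) ^ (p + k) ≡⟨ cong (_* (p + k) ^ (p + k)) ([a*k]^[b*k]≡[a^b]^k*k^[b*k] c (suc c) k) ⟨
  (c * k) ^ E * (p + k) ^ (p + k) ≤⟨ subst (λ e → (c * k) ^ e * (p + k) ^ (p + k) ≤ p ^ (p + k) * e ^ e)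
                                           (+-comm (c * k) k)
                                           ([1+k/a]^[a+k]-antitone k {{m*n≢0 c k}} ck≤p) ⟩
  p ^ (p + k) * E ^ E       ≡⟨ cong (p ^ (p + k) *_) ([a*k]^[b*k]≡[a^b]^k*k^[b*k] (suc c) (suc c) k) ⟩
  p ^ (p + k) * (D * K)     ≡⟨ x∙yz≈y∙xz (p ^ (p + k)) D K ⟩
  D * (p ^ (p + k) * K)     ≡⟨ *-assoc D (p ^ (p + k)) K ⟨
  D * p ^ (p + k) * K       ∎)
  where
  open ≤-Reasoning
  E = suc c * k
  K = k ^ E
  C = (c ^ suc c) ^ k
  D = (suc c ^ suc c) ^ k

J-bound : ∀ c k m p .{{_ : NonZero c}} .{{_ : NonZero k}} → m + m ≡ p + k → c * k ≤ p →
          J k m * k ^ k * (c ^ suc c) ^ k ≤ (suc c ^ suc c * (p + k + p)) ^ k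
J-bound c k m p m+m≡p+k ck≤p = *-cancelʳ-≤ _ _ P {{m^n≢0 p Q {{p≢0}}}} (begin
  J k m * k ^ k * C * P        ≡⟨ reorder (J k m) (k ^ k) C P ⟩
  C * (J k m * P * k ^ k)      ≤⟨ *-monoʳ-≤ C rankin ⟩
  C * (Q ^ Q * (Q + p) ^ k)    ≡⟨ *-assoc C (Q ^ Q) ((Q + p) ^ k) ⟨
  C * Q ^ Q * (Q + p) ^ k      ≤⟨ *-monoˡ-≤ ((Q + p) ^ k) ([1+k/p]^[p+k]≤[1+1/c]^[[1+c]k] c k p ck≤p) ⟩
  D * P * (Q + p) ^ k          ≡⟨ xy∙z≈xz∙y D P ((Q + p) ^ k) ⟩
  D * (Q + p) ^ k * P          ≡⟨ cong (_* P) (^-distribʳ-* (suc c ^ suc c) (Q + p) k) ⟨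
  (suc c ^ suc c * (Q + p)) ^ k * P ∎)
  where
  open ≤-Reasoning
  Q = p + k
  P = p ^ Q
  C = (c ^ suc c) ^ k
  D = (suc c ^ suc c) ^ k
  p≢0 : NonZero p
  p≢0 = >-nonZero (<-≤-trans (>-nonZero⁻¹ (c * k) {{m*n≢0 c k}}) ck≤p)
  rankin : J k m * P * k ^ k ≤ Q ^ Q * (Q + p) ^ k
  rankin = subst (λ e → J k m * p ^ e * k ^ k ≤ Q ^ e * (Q + p) ^ k) m+m≡p+k
                 (RankinWeight.rankin-bound p k m {{>-nonZero (<-≤-trans (>-nonZero⁻¹ k) (m≤n+m k p))}} k)
  reorder : ∀ j x y z → j * x * y * z ≡ y * (j * z * x)
  reorder = solve-∀

a*b^n≤x^n∧x<b*y⇒a<y^n : ∀ {a b x y} n .{{_ : NonZero n}} → a * b ^ n ≤ x ^ n → x < b * y → a < y ^ n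
a*b^n≤x^n∧x<b*y⇒a<y^n {a} {b} {x} {y} n ab≤x x<by = *-cancelʳ-< (b ^ n) a (y ^ n) (begin-strict
  a * b ^ n   ≤⟨ ab≤x ⟩
  x ^ n       <⟨ ^-monoˡ-< n x<by ⟩
  (b * y) ^ n ≡⟨ ^-distribʳ-* b y n ⟩
  b ^ n * y ^ n ≡⟨ *-comm (b ^ n) (y ^ n) ⟩
  y ^ n * b ^ n ∎)
  where open ≤-Reasoning

m+n≡o⇒m≤o : ∀ {m n o} → m + n ≡ o → m ≤ o
m+n≡o⇒m≤o {m} {n} refl = m≤m+n m n

m+1+n≡o⇒m<o : ∀ {m n o} → m + suc n ≡ o → m < o
m+1+n≡o⇒m<o {m} refl = m<m+n m z<s

[k+e]+[k+e]≡[k+e+e]+k : ∀ k e → k + e + (k + e) ≡ k + e + e + k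
[k+e]+[k+e]≡[k+e+e]+k = solve-∀

J-bound-m<2k : ∀ k e → e < k → J k (k + e) * k ^ k < (14 * (k + e)) ^ k
J-bound-m<2k k e e<k with m≤n⇒∃[o]m+o≡n e<k
... | r , refl = a*b^n≤x^n∧x<b*y⇒a<y^n k
  (J-bound 1 k (k + e) (k + e + e) ([k+e]+[k+e]≡[k+e+e]+k k e) (m+n≡o⇒m≤o (fits e r)))
  (m+1+n≡o⇒m<o (gap e r))
  where
  fits : ∀ e r → let k = suc e + r in 1 * k + (e + e) ≡ k + e + e
  fits = solve-∀
  gap : ∀ e r → let k = suc e + r in
                4 * (k + e + e + k + (k + e + e)) + suc (1 + r + r) ≡ 1 * (14 * (k + e))
  gap = solve-∀

J-bound-2k≤m : ∀ k e → 1 ≤ k → k ≤ e → J k (k + e) * k ^ k < (14 * (k + e)) ^ k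
J-bound-2k≤m (suc k') e (s≤s z≤n) k≤e with m≤n⇒∃[o]m+o≡n k≤e
... | r , refl = a*b^n≤x^n∧x<b*y⇒a<y^n k
  (J-bound 3 k (k + e) (k + e + e) ([k+e]+[k+e]≡[k+e+e]+k k e) (m+n≡o⇒m≤o (fits k' r)))
  (m+1+n≡o⇒m<o (gap k' r))
  where
  k = suc k'
  fits : ∀ k' r → let k = suc k' ; e = k + r in 3 * k + (r + r) ≡ k + e + e
  fits = solve-∀
  gap : ∀ k' r → let k = suc k' ; e = k + r in
        256 * (k + e + e + k + (k + e + e)) + suc (475 + 476 * k' + 110 * r) ≡ 81 * (14 * (k + e))
  gap = solve-∀

mainTheorem8 : (k m : ℕ) → 1 ≤ k → k ≤ m → J k m * k ^ k < (14 * m) ^ k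
mainTheorem8 k m 1≤k k≤m with m≤n⇒∃[o]m+o≡n k≤m
... | e , refl with <-≤-connex e k
...   | inj₁ e<k = J-bound-m<2k k e e<k
...   | inj₂ k≤e = J-bound-2k≤m k e 1≤k k≤e
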